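{- Let a sequence of transactions be given, let $G^*$ be an optimal network for maximum profit (defined in the context), assumed connected, with node set $V$, and let $T$ be the set of transactions it executes, with $C_{opt}$ the total capital locked on its channels. Then for any star graph $S(V)$ on the node set $V$ (with any node of $V$ as center), the transactions of $T$ can be executed in order on $S(V)$ with total locked capital $C_S\le 2C_{opt}$. Hence any star graph yields a $2$-approximate solution for the Channel Design for All Transactions problem.
   Context: A transaction is a triple $(s_i,r_i,v_i)$ (sender, receiver, value $v_i>0$); the input is a sequence $t_1,\dots,t_n$. A network is an undirected graph of channels; each channel has nonnegative initial capital on each of its two sides; transactions are processed in order, each routed along a path from sender to receiver, moving its value from the traversing side to the other side of each edge on the path, with all sides nonnegative at all times. The total (locked) capital of a network is the sum of the initial capitals on all sides of all channels. Each executed transaction earns fee $1-\epsilon$ and each channel costs $1$; profit is (fees) minus (number of channels). Channel Design for All Transactions problem: given the sequence, return a graph that achieves maximum profit with minimum capital; such a graph (with its executed transactions and minimum capital assignment) is an optimal network for maximum profit. The paper assumes throughout this part that the optimal graph is connected. -}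

module Defs where

open import Data.Nat using (ℕ; zero; suc; _+_; _*_; _∸_; _≤_; _<_)
open import Data.Fin using (Fin; _≟_)
open import Data.Fin.Subset using (Subset; _∈_)
open import Data.Bool using (Bool; true; false; if_then_else_)
open import Data.Product using (Σ; _×_; _,_; proj₁; proj₂; swap)
open import Data.Sum using (_⊎_)
open import Data.List using (List; []; _∷_; length; lookup; allFin; map)
open import Data.Nat.ListAction using (sum)
open import Data.List.Relation.Unary.All using (All)
open import Data.List.Relation.Unary.Any using (Any)
open import Data.List.Relation.Unary.AllPairs using (AllPairs)
open import Data.List.Relation.Unary.Unique.Propositional using (Unique)
open import Data.List.Relation.Binary.Sublist.Propositional using (_⊆_)
open import Data.List.Membership.Propositional renaming (_∈_ to _∈ₗ_)
open import Data.Integer using (+_)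
open import Data.Rational using (ℚ; _/_; _-_) renaming (_*_ to _*ℚ_; _≤_ to _≤ℚ_)
open import Relation.Nullary using (yes; no; ¬_)
open import Relation.Binary.PropositionalEquality using (_≡_; _≢_)

record Tx (n : ℕ) : Set where
  constructor tx
  field
    sender   : Fin n
    receiver : Fin n
    value    : ℕ
open Tx public

-- A network: a node set V ⊆ Fin n and a list of channels (undirected
-- edges, each written as an ordered pair (u , w) only to name its two
-- sides).

Edge : ℕ → Set
Edge n = Fin n × Fin n

record Graph (n : ℕ) : Set where
  field
    V      : Subset n
    E      : List (Edge n)
    E⊆V    : All (λ e → (proj₁ e ∈ V) × (proj₂ e ∈ V)) E
    noLoop : All (λ e → proj₁ e ≢ proj₂ e) E
    simple : AllPairs (λ e f → (e ≢ f) × (e ≢ swap f)) E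
open Graph public

Ch : ∀ {n} → List (Edge n) → Set
Ch E = Fin (length E)

-- A hop: a channel together with a traversal direction
-- (true: from first to second component, false: the reverse).
Hop : ∀ {n} → List (Edge n) → Set
Hop E = Ch E × Bool

hopFrom hopTo : ∀ {n} (E : List (Edge n)) → Hop E → Fin n
hopFrom E (i , true)  = proj₁ (lookup E i)
hopFrom E (i , false) = proj₂ (lookup E i)
hopTo   E (i , true)  = proj₂ (lookup E i)
hopTo   E (i , false) = proj₁ (lookup E i)

data Walk {n} (E : List (Edge n)) : Fin n → Fin n → List (Hop E) → List (Fin n) → Set where
  here : ∀ {x} → Walk E x x [] (x ∷ [])
  step : ∀ {x z p vs} (h : Hop E) → hopFrom E h ≡ x →
         Walk E (hopTo E h) z p vs → Walk E x z (h ∷ p) (x ∷ vs)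

IsPath : ∀ {n} (E : List (Edge n)) → Fin n → Fin n → List (Hop E) → Set
IsPath E x y p = Σ (List _) λ vs → Walk E x y p vs × Unique vs

Connected : ∀ {n} → Graph n → Set
Connected G = ∀ x y → x ∈ V G → y ∈ V G →
  Σ (List (Hop (E G))) λ p → Σ (List _) λ vs → Walk (E G) x y p vs

-- Balances: for each channel, (capital on the side of the first
-- endpoint , capital on the side of the second endpoint).

Balances : ∀ {n} → List (Edge n) → Set
Balances E = Ch E → ℕ × ℕ

move : ∀ {n} {E : List (Edge n)} → ℕ → Hop E → Balances E → Balances E
move v (i , d) b j with i ≟ j
... | no _  = b j
... | yes _ = if d then (proj₁ (b j) ∸ v , proj₂ (b j) + v)
                   else (proj₁ (b j) + v , proj₂ (b j) ∸ v)

CanMove : ∀ {n} {E : List (Edge n)} → ℕ → Hop E → Balances E → Set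
CanMove v (i , true)  b = v ≤ proj₁ (b i)
CanMove v (i , false) b = v ≤ proj₂ (b i)

-- Routing value v along hop list p takes balances b to b'
-- (all sides stay nonnegative since each move is checked).
data Route {n} (E : List (Edge n)) (v : ℕ) : Balances E → List (Hop E) → Balances E → Set where
  done : ∀ {b} → Route E v b [] b
  hop  : ∀ {b b' h p} → CanMove {E = E} v h b → Route E v (move {E = E} v h b) p b' → Route E v b (h ∷ p) b'

data Exec {n} (E : List (Edge n)) : Balances E → List (Tx n) → Balances E → Set where
  done : ∀ {b} → Exec E b [] b
  run  : ∀ {b b₁ b' t ts} (p : List (Hop E)) →
         IsPath E (sender t) (receiver t) p →
         Route E (value t) b p b₁ → Exec E b₁ ts b' → Exec E b (t ∷ ts) b'

totalCap : ∀ {n} {E : List (Edge n)} → Balances E → ℕ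
totalCap {E = E} c = sum (map (λ i → proj₁ (c i) + proj₂ (c i)) (allFin (length E)))

Feasible : ∀ {n} → List (Tx n) → (G : Graph n) → List (Tx n) → Balances (E G) → Set
Feasible ts G T c = (T ⊆ ts) × Σ (Balances (E G)) λ b' → Exec (E G) c T b'

ℕtoℚ : ℕ → ℚ
ℕtoℚ k = (+ k) / 1

profit : ∀ {n} → ℚ → Graph n → List (Tx n) → ℚ
profit ε G T = ((ℕtoℚ 1 - ε) *ℚ ℕtoℚ (length T)) - ℕtoℚ (length (E G))

Optimal : ∀ {n} → ℚ → List (Tx n) → (G : Graph n) → List (Tx n) → Balances (E G) → Set
Optimal {n} ε ts G T c =
  Feasible ts G T c ×
  (∀ (G' : Graph n) T' c' → Feasible ts G' T' c' → profit ε G' T' ≤ℚ profit ε G T) ×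
  (∀ (G' : Graph n) T' c' → Feasible ts G' T' c' → profit ε G' T' ≡ profit ε G T →
     totalCap {E = E G} c ≤ totalCap {E = E G'} c')

-- S is a star graph on node set W with center z ∈ W: its node set is W,
-- every channel has z as an endpoint, and every other node of W is
-- joined to z by a channel (S being simple, these are all its channels).
IsStar : ∀ {n} → Graph n → Subset n → Fin n → Set
IsStar S W z =
  (V S ≡ W) × (z ∈ W) ×
  All (λ e → (proj₁ e ≡ z) ⊎ (proj₂ e ≡ z)) (E S) ×
  (∀ w → w ∈ W → w ≢ z → Any (λ e → (e ≡ (z , w)) ⊎ (e ≡ (w , z))) (E S))

module Submission where

-- Only feasibility of (G , T , c) and connectivity of G are used.  For a node
-- w, outNeed T w and inNeed T w are the least capital w must hold on its own
-- channel sides, resp. that must face it from its partners, for its share of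
-- T to be executed in order (the function need).  In any network, the
-- capital held by w and the capital facing w telescope along every route, so
-- an execution of T from c forces outNeed T w ≤ held c w and
-- inNeed T w ≤ facing c w (outNeed-bound, inNeed-bound).  On the star, give
-- each leaf's channel outNeed T on the leaf's side and inNeed T on the
-- centre's; routing every payment through the centre preserves this supply
-- (module Star), so T executes.  Summed over the distinct leaves, held plus
-- facing capital counts every channel of G at most twice (capital-twice).
-- Finally the parent channels of a breadth-first tree rooted at the centre
-- inject the leaves into the channels of G (module Reachability), so the
-- star has no more channels and at least the same profit.

open import Defs

open import Data.Bool using (Bool; true; false; not)
open import Data.Empty using (⊥; ⊥-elim)
open import Data.Fin using (Fin; zero; suc; _≟_; punchIn)
open import Data.Fin.Properties using (punchInᵢ≢i; suc-injective; 0≢1+n; injective⇒≤)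
open import Data.Fin.Subset using (Subset; _∈_)
import Data.Integer as ℤ
import Data.Integer.Properties as ℤ
open import Data.List using (List; []; _∷_; length; lookup; tabulate)
open import Data.List.Membership.Propositional using (lose)
open import Data.List.Membership.Propositional.Properties using (∈-lookup)
open import Data.List.Properties using (map-tabulate)
open import Data.List.Relation.Unary.All as All using (All; []; _∷_)
open import Data.List.Relation.Unary.AllPairs using (AllPairs; []; _∷_)
open import Data.List.Relation.Unary.Any using (Any; index; any?)
open import Data.List.Relation.Unary.Any.Properties using (lookup-index)
open import Data.Nat using (ℕ; zero; suc; _+_; _*_; _∸_; _≤_; _<_; z≤n; s≤s)
open import Data.Nat.Coprimality as Coprime using (1-coprimeTo)
open import Data.Nat.ListAction using (sum)
open import Data.Nat.Properties
  using ( +-comm; +-identityʳ; +-cancelʳ-≡; +-mono-≤; +-monoʳ-≤; +-monoˡ-≤; ≤-refl; ≤-trans; ≤-reflexive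
        ; <-irrefl; n≤1+n; m≤n+m∸n; m+n∸n≡m; m∸n+n≡m; m+n≤o⇒n≤o; m+n≤o⇒m≤o∸n; m≤n+o⇒m∸n≤o
        ; +-commutativeSemigroup; +-0-commutativeMonoid; module ≤-Reasoning)
open import Algebra.Properties.CommutativeMonoid.Sum +-0-commutativeMonoid
  using (sum-cong-≗; sum-remove; ∑-distrib-+; ∑-comm; sum-replicate-zero) renaming (sum to ∑)
open import Algebra.Properties.CommutativeSemigroup +-commutativeSemigroup using (interchange; xy∙z≈xz∙y)
open import Data.Product using (Σ; _×_; _,_; proj₁; proj₂; swap)
open import Data.Rational as ℚ using (ℚ; 0ℚ; 1ℚ; *≤*) renaming (_<_ to _<ℚ_; _≤_ to _≤ℚ_)
open import Data.Rational.Properties using (normalize-coprime; neg-antimono-≤) renaming (+-monoʳ-≤ to +-monoʳ-≤ℚ)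
open import Data.Sum using (_⊎_; inj₁; inj₂)
open import Function using (_∘′_)
open import Relation.Binary.PropositionalEquality
  using (_≡_; _≢_; refl; sym; trans; cong; cong₂; subst; subst₂; module ≡-Reasoning)
open import Relation.Nullary using (Dec; yes; no; does; contradiction)
open import Relation.Nullary.Decidable using (_⊎-dec_; _×-dec_)

private variable
  n m : ℕ

total : ∀ {k} → (Fin k → ℕ × ℕ) → Fin k → ℕ
total c i = proj₁ (c i) + proj₂ (c i)

totalCap-∑ : (E : List (Edge n)) (c : Balances E) → totalCap {E = E} c ≡ ∑ (total c)
totalCap-∑ E c = trans (cong sum (map-tabulate (λ i → i) (total c))) (sum-tabulate (total c))
  where
  sum-tabulate : ∀ {k} (f : Fin k → ℕ) → sum (tabulate f) ≡ ∑ f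
  sum-tabulate {zero}  f = refl
  sum-tabulate {suc k} f = cong (f zero +_) (sum-tabulate (λ j → f (suc j)))

∑-mono : {F G : Fin m → ℕ} → (∀ j → F j ≤ G j) → ∑ F ≤ ∑ G
∑-mono {zero}  F≤G = z≤n
∑-mono {suc m} F≤G = +-mono-≤ (F≤G zero) (∑-mono (λ j → F≤G (suc j)))

∑-pointChange : (F G : Fin m → ℕ) (i : Fin m) {X Y : ℕ} →
  (∀ j → j ≢ i → F j ≡ G j) → F i + X ≡ G i + Y → ∑ F + X ≡ ∑ G + Y
∑-pointChange {suc m} F G i {X} {Y} same changed = begin
  ∑ F + X                 ≡⟨ cong (_+ X) (sum-remove F) ⟩
  F i + rest F + X        ≡⟨ xy∙z≈xz∙y (F i) (rest F) X ⟩
  F i + X + rest F        ≡⟨ cong₂ _+_ changed (sum-cong-≗ λ j → same (punchIn i j) (punchInᵢ≢i i j)) ⟩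
  G i + Y + rest G        ≡⟨ xy∙z≈xz∙y (G i) Y (rest G) ⟩
  G i + rest G + Y        ≡⟨ cong (_+ Y) (sym (sum-remove G)) ⟩
  ∑ G + Y                 ∎
  where
  open ≡-Reasoning
  rest : (Fin (suc m) → ℕ) → ℕ
  rest H = ∑ (λ j → H (punchIn i j))

mass : Fin n → ℕ → Fin n → ℕ
mass a X w with a ≟ w
... | yes _ = X
... | no  _ = 0

mass-here : (a : Fin n) (X : ℕ) → mass a X a ≡ X
mass-here a X with a ≟ a
... | yes _   = refl
... | no  a≢a = contradiction refl a≢a

mass-elsewhere : {a w : Fin n} (X : ℕ) → a ≢ w → mass a X w ≡ 0
mass-elsewhere {a = a} {w} X a≢w with a ≟ w
... | yes a≡w = contradiction a≡w a≢w
... | no  _   = refl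

mass-+ : (a : Fin n) (x y : ℕ) (w : Fin n) → mass a x w + mass a y w ≡ mass a (x + y) w
mass-+ a x y w with a ≟ w
... | yes _ = refl
... | no  _ = refl

mass-transfer : {a c : Fin n} (w : Fin n) {x y v : ℕ} → a ≢ c → v ≤ x →
  mass a (x ∸ v) w + mass c (y + v) w + mass a v w ≡ mass a x w + mass c y w + mass c v w
mass-transfer {a = a} {c} w {x} {y} {v} a≢c v≤x with a ≟ w | c ≟ w
... | yes refl | yes refl = contradiction refl a≢c
... | yes _    | no  _    =
  trans (cong (_+ v) (+-identityʳ (x ∸ v))) (trans (m∸n+n≡m v≤x) (sym (trans (+-identityʳ (x + 0)) (+-identityʳ x))))
... | no  _    | yes _    = +-identityʳ (y + v)
... | no  _    | no  _    = refl

∑-mass-injective : (a : Fin n) (X : ℕ) (f : Fin m → Fin n) → (∀ {i j} → f i ≡ f j → i ≡ j) →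
  ∑ (λ j → mass a X (f j)) ≤ X
∑-mass-injective {m = zero} a X f f-injective = z≤n
∑-mass-injective {m = suc m} a X f f-injective with a ≟ f zero
... | no  _    = ∑-mass-injective a X (λ j → f (suc j)) (λ same → suc-injective (f-injective same))
... | yes refl = ≤-reflexive (trans (cong (X +_) rest-vanishes) (+-identityʳ X))
  where
  rest-vanishes : ∑ (λ j → mass (f zero) X (f (suc j))) ≡ 0
  rest-vanishes = trans (sum-cong-≗ {y = λ _ → 0} elsewhere) (sum-replicate-zero m)
    where
    elsewhere : ∀ j → mass (f zero) X (f (suc j)) ≡ 0
    elsewhere j = mass-elsewhere X (λ same → 0≢1+n (f-injective same))

allPairs-lookup : ∀ {A : Set} {R : A → A → Set} {xs : List A} → AllPairs R xs →
  ∀ {i j : Fin (length xs)} → i ≢ j → R (lookup xs i) (lookup xs j) ⊎ R (lookup xs j) (lookup xs i)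
allPairs-lookup (_ ∷ _)   {zero}  {zero}  i≢j = contradiction refl i≢j
allPairs-lookup (Rx ∷ _)  {zero}  {suc j} _   = inj₁ (All.lookup Rx (∈-lookup j))
allPairs-lookup (Rx ∷ _)  {suc i} {zero}  _   = inj₂ (All.lookup Rx (∈-lookup i))
allPairs-lookup (_ ∷ Rxs) {suc i} {suc j} i≢j = allPairs-lookup Rxs (i≢j ∘′ cong suc)

-- Sides of a channel in the orientation of a hop: (capital on the side
-- the hop leaves , capital on the side it enters).
orient : Bool → ℕ × ℕ → ℕ × ℕ
orient true  p = p
orient false p = swap p

sides : ∀ {k} → Fin k × Bool → ℕ × ℕ → ℕ × ℕ
sides (_ , d) p = orient d p

orient-involutive : (d : Bool) (p : ℕ × ℕ) → orient d (orient d p) ≡ p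
orient-involutive true  p = refl
orient-involutive false p = refl

orient-total : (d : Bool) (p : ℕ × ℕ) → proj₁ (orient d p) + proj₂ (orient d p) ≡ proj₁ p + proj₂ p
orient-total true  p = refl
orient-total false p = +-comm (proj₂ p) (proj₁ p)

pay receive : ℕ → ℕ × ℕ → ℕ × ℕ
pay     v p = (proj₁ p ∸ v , proj₂ p + v)
receive v p = (proj₁ p + v , proj₂ p ∸ v)

reverse : ∀ {k} → Fin k × Bool → Fin k × Bool
reverse (i , d) = (i , not d)

-- On a channel e with sides p: the capital node w holds on its own side,
-- and the capital held on the opposite side by w's partner.
heldOn facingOn : Edge n → ℕ × ℕ → Fin n → ℕ
heldOn   e p w = mass (proj₁ e) (proj₁ p) w + mass (proj₂ e) (proj₂ p) w
facingOn e p w = mass (proj₁ e) (proj₂ p) w + mass (proj₂ e) (proj₁ p) w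

-- need src dst ts w: the least capital w must have at hand so that, going
-- through ts in order, it can always pay the values of the transactions with
-- src t ≡ w, given that it receives those with dst t ≡ w.  Computed from the
-- end: paying v raises it by v, receiving v lowers it by v (not below 0).
need : (src dst : Tx n → Fin n) → List (Tx n) → Fin n → ℕ
need src dst []       w = 0
need src dst (t ∷ ts) w = (need src dst ts w + mass (src t) (value t) w) ∸ mass (dst t) (value t) w

outNeed inNeed : List (Tx n) → Fin n → ℕ
outNeed = need sender receiver
inNeed  = need receiver sender

module _ (src dst : Tx n → Fin n) (t : Tx n) (ts : List (Tx n)) where

  need-atSource : src t ≢ dst t → need src dst (t ∷ ts) (src t) ≡ need src dst ts (src t) + value t
  need-atSource s≢d rewrite mass-here (src t) (value t) | mass-elsewhere (value t) (s≢d ∘′ sym) = refl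

  need-atTarget : src t ≢ dst t → need src dst (t ∷ ts) (dst t) ≡ need src dst ts (dst t) ∸ value t
  need-atTarget s≢d rewrite mass-here (dst t) (value t) | mass-elsewhere (value t) s≢d =
    cong (_∸ value t) (+-identityʳ _)

  need-idle : ∀ w → src t ≢ w → dst t ≢ w → need src dst (t ∷ ts) w ≡ need src dst ts w
  need-idle w s≢w d≢w rewrite mass-elsewhere (value t) s≢w | mass-elsewhere (value t) d≢w = +-identityʳ _

  need-loop : ∀ w → src t ≡ dst t → need src dst (t ∷ ts) w ≡ need src dst ts w
  need-loop w s≡d rewrite s≡d = m+n∸n≡m (need src dst ts w) (mass (dst t) (value t) w)

Funded : List (Tx n) → Fin n → ℕ × ℕ → Set
Funded ts w q = outNeed ts w ≤ proj₁ q × inNeed ts w ≤ proj₂ q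

module _ (t : Tx n) (ts : List (Tx n)) where

  private
    withdraw : ∀ A {v P} → A + v ≤ P → v ≤ P × A ≤ P ∸ v
    withdraw A A+v≤P = m+n≤o⇒n≤o A A+v≤P , m+n≤o⇒m≤o∸n A A+v≤P

    deposit : ∀ A v {Q} → A ∸ v ≤ Q → A ≤ Q + v
    deposit A v {Q} A∸v≤Q = ≤-trans (m≤n+m∸n A v) (≤-trans (+-monoʳ-≤ v A∸v≤Q) (≤-reflexive (+-comm v Q)))

  fund-send : ∀ {q} → sender t ≢ receiver t → Funded (t ∷ ts) (sender t) q →
    value t ≤ proj₁ q × Funded ts (sender t) (pay (value t) q)
  fund-send {q} s≢r (out , in′)
    with withdraw (outNeed ts (sender t)) (subst (_≤ proj₁ q) (need-atSource sender receiver t ts s≢r) out)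
  ... | v≤x , out′ =
    v≤x , out′ ,
    deposit (inNeed ts (sender t)) (value t) (subst (_≤ proj₂ q) (need-atTarget receiver sender t ts (s≢r ∘′ sym)) in′)

  fund-receive : ∀ {q} → sender t ≢ receiver t → Funded (t ∷ ts) (receiver t) q →
    value t ≤ proj₂ q × Funded ts (receiver t) (receive (value t) q)
  fund-receive {q} s≢r (out , in′)
    with withdraw (inNeed ts (receiver t)) (subst (_≤ proj₂ q) (need-atSource receiver sender t ts (s≢r ∘′ sym)) in′)
  ... | v≤y , in″ =
    v≤y ,
    deposit (outNeed ts (receiver t)) (value t) (subst (_≤ proj₁ q) (need-atTarget sender receiver t ts s≢r) out) ,
    in″

  fund-idle : ∀ {q} w → sender t ≢ w → receiver t ≢ w → Funded (t ∷ ts) w q → Funded ts w q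
  fund-idle {q} w s≢w r≢w (out , in′) =
    subst (_≤ proj₁ q) (need-idle sender receiver t ts w s≢w r≢w) out ,
    subst (_≤ proj₂ q) (need-idle receiver sender t ts w r≢w s≢w) in′

  fund-loop : ∀ {q} w → sender t ≡ receiver t → Funded (t ∷ ts) w q → Funded ts w q
  fund-loop {q} w s≡r (out , in′) =
    subst (_≤ proj₁ q) (need-loop sender receiver t ts w s≡r) out ,
    subst (_≤ proj₂ q) (need-loop receiver sender t ts w (sym s≡r)) in′

module Network (E : List (Edge n)) where

  canMove-intro : ∀ v (h : Hop E) b → v ≤ proj₁ (sides h (b (proj₁ h))) → CanMove {E = E} v h b
  canMove-intro v (i , true)  b v≤x = v≤x
  canMove-intro v (i , false) b v≤x = v≤x

  canMove-elim : ∀ v (h : Hop E) b → CanMove {E = E} v h b → v ≤ proj₁ (sides h (b (proj₁ h)))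
  canMove-elim v (i , true)  b v≤x = v≤x
  canMove-elim v (i , false) b v≤x = v≤x

  canMove-reverse : ∀ v (h : Hop E) b → v ≤ proj₂ (sides h (b (proj₁ h))) → CanMove {E = E} v (reverse h) b
  canMove-reverse v (i , true)  b v≤y = v≤y
  canMove-reverse v (i , false) b v≤y = v≤y

  move-elsewhere : ∀ v (h : Hop E) b j → proj₁ h ≢ j → move {E = E} v h b j ≡ b j
  move-elsewhere v (i , d) b j i≢j with i ≟ j
  ... | yes i≡j = contradiction i≡j i≢j
  ... | no  _   = refl

  move-on : ∀ v (h : Hop E) b → sides h (move {E = E} v h b (proj₁ h)) ≡ pay v (sides h (b (proj₁ h)))
  move-on v (i , true) b with i ≟ i
  ... | yes _   = refl
  ... | no  i≢i = contradiction refl i≢i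
  move-on v (i , false) b with i ≟ i
  ... | yes _   = refl
  ... | no  i≢i = contradiction refl i≢i

  move-reverse : ∀ v (h : Hop E) b → sides h (move {E = E} v (reverse h) b (proj₁ h)) ≡ receive v (sides h (b (proj₁ h)))
  move-reverse v (i , true)  b = cong swap (move-on v (i , false) b)
  move-reverse v (i , false) b = cong swap (move-on v (i , true) b)

  hopFrom-reverse : (h : Hop E) → hopFrom E (reverse h) ≡ hopTo E h
  hopFrom-reverse (i , true)  = refl
  hopFrom-reverse (i , false) = refl

  hopTo-reverse : (h : Hop E) → hopTo E (reverse h) ≡ hopFrom E h
  hopTo-reverse (i , true)  = refl
  hopTo-reverse (i , false) = refl

  hop-ends : (h : Hop E) → lookup E (proj₁ h) ≡ (hopFrom E h , hopTo E h) ⊎ lookup E (proj₁ h) ≡ (hopTo E h , hopFrom E h)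
  hop-ends (i , true)  = inj₁ refl
  hop-ends (i , false) = inj₂ refl

  hop-noLoop : All (λ e → proj₁ e ≢ proj₂ e) E → (h : Hop E) → hopFrom E h ≢ hopTo E h
  hop-noLoop noLoops (i , true)  = All.lookup noLoops (∈-lookup i)
  hop-noLoop noLoops (i , false) = All.lookup noLoops (∈-lookup i) ∘′ sym

  update-at : (Q : Ch E → ℕ × ℕ → Set) (i : Ch E) {b b′ : Balances E} →
    (∀ j → i ≢ j → b′ j ≡ b j) → Q i (b′ i) → (∀ j → i ≢ j → Q j (b j)) → ∀ j → Q j (b′ j)
  update-at Q i same Qi Qothers j with i ≟ j
  ... | yes refl = Qi
  ... | no  i≢j  = subst (Q j) (sym (same j i≢j)) (Qothers j i≢j)

  hop-local : (φ : Edge n → ℕ × ℕ → ℕ) (v : ℕ) (h : Hop E) (b : Balances E) {X Y : ℕ} →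
    φ (lookup E (proj₁ h)) (move {E = E} v h b (proj₁ h)) + X ≡ φ (lookup E (proj₁ h)) (b (proj₁ h)) + Y →
    ∑ (λ j → φ (lookup E j) (move {E = E} v h b j)) + X ≡ ∑ (λ j → φ (lookup E j) (b j)) + Y
  hop-local φ v h b =
    ∑-pointChange (λ j → φ (lookup E j) (move {E = E} v h b j)) (λ j → φ (lookup E j) (b j)) (proj₁ h)
      (λ j j≢i → cong (φ (lookup E j)) (move-elsewhere v h b j (j≢i ∘′ sym)))

  held facing : Balances E → Fin n → ℕ
  held   b w = ∑ (λ j → heldOn   (lookup E j) (b j) w)
  facing b w = ∑ (λ j → facingOn (lookup E j) (b j) w)

  heldOn-oriented : (h : Hop E) (p : ℕ × ℕ) (w : Fin n) → heldOn (lookup E (proj₁ h)) p w ≡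
    mass (hopFrom E h) (proj₁ (sides h p)) w + mass (hopTo E h) (proj₂ (sides h p)) w
  heldOn-oriented (i , true)  p w = refl
  heldOn-oriented (i , false) p w = +-comm (mass (proj₁ (lookup E i)) (proj₁ p) w) _

  facingOn-oriented : (h : Hop E) (p : ℕ × ℕ) (w : Fin n) → facingOn (lookup E (proj₁ h)) p w ≡
    mass (hopTo E h) (proj₁ (sides h p)) w + mass (hopFrom E h) (proj₂ (sides h p)) w
  facingOn-oriented (i , true)  p w = +-comm (mass (proj₁ (lookup E i)) (proj₂ p) w) _
  facingOn-oriented (i , false) p w = refl

  held-hop : All (λ e → proj₁ e ≢ proj₂ e) E → ∀ w v (h : Hop E) b → CanMove {E = E} v h b →
    held (move {E = E} v h b) w + mass (hopFrom E h) v w ≡ held b w + mass (hopTo E h) v w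
  held-hop noLoops w v h b canMove = hop-local (λ e p → heldOn e p w) v h b (begin
      heldOn e (b′ i) w + mass from v w
        ≡⟨ cong (_+ mass from v w) (heldOn-oriented h _ w) ⟩
      mass from (proj₁ (sides h (b′ i))) w + mass to (proj₂ (sides h (b′ i))) w + mass from v w
        ≡⟨ cong (λ q → mass from (proj₁ q) w + mass to (proj₂ q) w + mass from v w) (move-on v h b) ⟩
      mass from (x ∸ v) w + mass to (y + v) w + mass from v w
        ≡⟨ mass-transfer w (hop-noLoop noLoops h) (canMove-elim v h b canMove) ⟩
      mass from x w + mass to y w + mass to v w
        ≡⟨ cong (_+ mass to v w) (sym (heldOn-oriented h (b i) w)) ⟩
      heldOn e (b i) w + mass to v w ∎)
    where
    open ≡-Reasoning
    i = proj₁ h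
    e = lookup E i
    from = hopFrom E h
    to = hopTo E h
    x = proj₁ (sides h (b i))
    y = proj₂ (sides h (b i))
    b′ = move {E = E} v h b

  facing-hop : All (λ e → proj₁ e ≢ proj₂ e) E → ∀ w v (h : Hop E) b → CanMove {E = E} v h b →
    facing (move {E = E} v h b) w + mass (hopTo E h) v w ≡ facing b w + mass (hopFrom E h) v w
  facing-hop noLoops w v h b canMove = hop-local (λ e p → facingOn e p w) v h b (begin
      facingOn e (b′ i) w + mass to v w
        ≡⟨ cong (_+ mass to v w) (facingOn-oriented h _ w) ⟩
      mass to (proj₁ (sides h (b′ i))) w + mass from (proj₂ (sides h (b′ i))) w + mass to v w
        ≡⟨ cong (λ q → mass to (proj₁ q) w + mass from (proj₂ q) w + mass to v w) (move-on v h b) ⟩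
      mass to (x ∸ v) w + mass from (y + v) w + mass to v w
        ≡⟨ mass-transfer w (hop-noLoop noLoops h ∘′ sym) (canMove-elim v h b canMove) ⟩
      mass to x w + mass from y w + mass from v w
        ≡⟨ cong (_+ mass from v w) (sym (facingOn-oriented h (b i) w)) ⟩
      facingOn e (b i) w + mass from v w ∎)
    where
    open ≡-Reasoning
    i = proj₁ h
    e = lookup E i
    from = hopFrom E h
    to = hopTo E h
    x = proj₁ (sides h (b i))
    y = proj₂ (sides h (b i))
    b′ = move {E = E} v h b

  held-route : All (λ e → proj₁ e ≢ proj₂ e) E → ∀ w v {x y p vs b b₁} →
    Walk E x y p vs → Route E v b p b₁ → held b₁ w + mass x v w ≡ held b w + mass y v w
  held-route noLoops w v here done = refl
  held-route noLoops w v {y = y} {b = b} {b₁} (step h refl walk) (hop canMove route) =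
    +-cancelʳ-≡ (mass (hopTo E h) v w) _ _ (begin
      held b₁ w + mass from v w + mass to v w  ≡⟨ xy∙z≈xz∙y (held b₁ w) _ _ ⟩
      held b₁ w + mass to v w + mass from v w  ≡⟨ cong (_+ mass from v w) (held-route noLoops w v walk route) ⟩
      held b′ w + mass y v w + mass from v w   ≡⟨ xy∙z≈xz∙y (held b′ w) _ _ ⟩
      held b′ w + mass from v w + mass y v w   ≡⟨ cong (_+ mass y v w) (held-hop noLoops w v h b canMove) ⟩
      held b w + mass to v w + mass y v w      ≡⟨ xy∙z≈xz∙y (held b w) _ _ ⟩
      held b w + mass y v w + mass to v w      ∎)
    where
    open ≡-Reasoning
    from = hopFrom E h
    to = hopTo E h
    b′ = move {E = E} v h b

  facing-route : All (λ e → proj₁ e ≢ proj₂ e) E → ∀ w v {x y p vs b b₁} →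
    Walk E x y p vs → Route E v b p b₁ → facing b₁ w + mass y v w ≡ facing b w + mass x v w
  facing-route noLoops w v here done = refl
  facing-route noLoops w v {b = b} (step h refl walk) (hop canMove route) =
    trans (facing-route noLoops w v walk route) (facing-hop noLoops w v h b canMove)

  -- Whatever evolves along each route as a potential Φ does (gaining what
  -- dst receives, losing what src pays) bounds the requirement of w.
  need-bound : (src dst : Tx n → Fin n) (w : Fin n) (Φ : Balances E → ℕ) →
    (∀ {b t p b₁} → IsPath E (sender t) (receiver t) p → Route E (value t) b p b₁ →
       Φ b₁ + mass (src t) (value t) w ≡ Φ b + mass (dst t) (value t) w) →
    ∀ {b ts b′} → Exec E b ts b′ → need src dst ts w ≤ Φ b
  need-bound src dst w Φ potential done = z≤n
  need-bound src dst w Φ potential {b} (run {b₁ = b₁} {t = t} {ts = ts} p path route exec) =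
    m≤n+o⇒m∸n≤o _ (mass (dst t) (value t) w) (begin
      need src dst ts w + mass (src t) (value t) w ≤⟨ +-monoˡ-≤ _ (need-bound src dst w Φ potential exec) ⟩
      Φ b₁ + mass (src t) (value t) w            ≡⟨ potential path route ⟩
      Φ b + mass (dst t) (value t) w             ≡⟨ +-comm (Φ b) _ ⟩
      mass (dst t) (value t) w + Φ b             ∎)
    where open ≤-Reasoning

  outNeed-bound : All (λ e → proj₁ e ≢ proj₂ e) E → ∀ {c ts c′} → Exec E c ts c′ → ∀ w → outNeed ts w ≤ held c w
  outNeed-bound noLoops exec w =
    need-bound sender receiver w (λ b → held b w) (λ (_ , walk , _) → held-route noLoops w _ walk) exec

  inNeed-bound : All (λ e → proj₁ e ≢ proj₂ e) E → ∀ {c ts c′} → Exec E c ts c′ → ∀ w → inNeed ts w ≤ facing c w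
  inNeed-bound noLoops exec w =
    need-bound receiver sender w (λ b → facing b w) (λ (_ , walk , _) → facing-route noLoops w _ walk) exec

  hop-inV : {V : Subset n} → All (λ e → (proj₁ e ∈ V) × (proj₂ e ∈ V)) E → (h : Hop E) → (hopFrom E h ∈ V) × (hopTo E h ∈ V)
  hop-inV inV (i , true)  = All.lookup inV (∈-lookup i)
  hop-inV inV (i , false) = swap (All.lookup inV (∈-lookup i))

  walk-end : {V : Subset n} → All (λ e → (proj₁ e ∈ V) × (proj₂ e ∈ V)) E →
    ∀ {x y p vs} → Walk E x y p vs → x ≡ y ⊎ y ∈ V
  walk-end inV here = inj₁ refl
  walk-end inV (step h refl walk) with walk-end inV walk
  ... | inj₁ refl = inj₂ (proj₂ (hop-inV inV h))
  ... | inj₂ y∈V  = inj₂ y∈V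

  walk-inV : {V : Subset n} → All (λ e → (proj₁ e ∈ V) × (proj₂ e ∈ V)) E →
    ∀ {x y p vs} → Walk E x y p vs → x ≢ y → (x ∈ V) × (y ∈ V)
  walk-inV inV walk x≢y with walk-end inV walk | walk
  ... | inj₁ x≡y | _             = contradiction x≡y x≢y
  ... | inj₂ _   | here          = contradiction refl x≢y
  ... | inj₂ y∈V | step h refl _ = proj₁ (hop-inV inV h) , y∈V

  exec-inV : {V : Subset n} → All (λ e → (proj₁ e ∈ V) × (proj₂ e ∈ V)) E → ∀ {b ts b′} → Exec E b ts b′ →
    All (λ t → sender t ≢ receiver t → (sender t ∈ V) × (receiver t ∈ V)) ts
  exec-inV inV done = []
  exec-inV inV (run p (_ , walk , _) route exec) = walk-inV inV walk ∷ exec-inV inV exec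

  path₀ : ∀ {x y} → x ≡ y → IsPath E x y []
  path₀ refl = _ , here , [] ∷ []

  path₁ : ∀ {x y} (h : Hop E) → x ≢ y → hopFrom E h ≡ x → hopTo E h ≡ y → IsPath E x y (h ∷ [])
  path₁ h x≢y refl refl = _ , step h refl here , (x≢y ∷ []) ∷ [] ∷ []

  path₂ : ∀ {x m y} (h₁ h₂ : Hop E) → x ≢ m → m ≢ y → x ≢ y →
    hopFrom E h₁ ≡ x → hopTo E h₁ ≡ m → hopFrom E h₂ ≡ m → hopTo E h₂ ≡ y → IsPath E x y (h₁ ∷ h₂ ∷ [])
  path₂ h₁ h₂ x≢m m≢y x≢y refl refl m≡ refl =
    _ , step h₁ refl (step h₂ m≡ here) , (x≢m ∷ x≢y ∷ []) ∷ (m≢y ∷ []) ∷ [] ∷ []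

  distinct-channels : AllPairs (λ e f → (e ≢ f) × (e ≢ swap f)) E → ∀ {i j : Ch E} → i ≢ j →
    (lookup E i ≢ lookup E j) × (lookup E i ≢ swap (lookup E j))
  distinct-channels simple i≢j with allPairs-lookup simple i≢j
  ... | inj₁ distinct = distinct
  ... | inj₂ (j≢i , j≢swap-i) = (j≢i ∘′ sym) , (λ i≡swap-j → j≢swap-i (cong swap (sym i≡swap-j)))

  atEnds : Ch E → ℕ → Fin n → ℕ
  atEnds i X w = mass (proj₁ (lookup E i)) X w + mass (proj₂ (lookup E i)) X w

  held+facing : ∀ c w → held c w + facing c w ≡ ∑ (λ i → atEnds i (total c i) w)
  held+facing c w =
    trans (sym (∑-distrib-+ (λ i → heldOn (lookup E i) (c i) w) (λ i → facingOn (lookup E i) (c i) w)))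
          (sum-cong-≗ channel)
    where
    channel : ∀ i → heldOn (lookup E i) (c i) w + facingOn (lookup E i) (c i) w ≡ atEnds i (total c i) w
    channel i = begin
      (ma x + mb y) + (ma y + mb x)       ≡⟨ interchange (ma x) (mb y) (ma y) (mb x) ⟩
      (ma x + ma y) + (mb y + mb x)       ≡⟨ cong₂ _+_ (mass-+ a x y w) (mass-+ b y x w) ⟩
      mass a (x + y) w + mass b (y + x) w ≡⟨ cong (λ u → mass a (x + y) w + mass b u w) (+-comm y x) ⟩
      mass a (x + y) w + mass b (x + y) w ∎
      where
      open ≡-Reasoning
      a = proj₁ (lookup E i)
      b = proj₂ (lookup E i)
      x = proj₁ (c i)
      y = proj₂ (c i)
      ma mb : ℕ → ℕ
      ma u = mass a u w
      mb u = mass b u w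

  -- Over distinct nodes, held plus facing capital counts every channel at
  -- most twice (once for each endpoint).
  capital-twice : ∀ c {m} (f : Fin m → Fin n) → (∀ {i j} → f i ≡ f j → i ≡ j) →
    ∑ (λ j → held c (f j) + facing c (f j)) ≤ 2 * totalCap {E = E} c
  capital-twice c f f-injective = begin
    ∑ (λ j → held c (f j) + facing c (f j))         ≡⟨ sum-cong-≗ (λ j → held+facing c (f j)) ⟩
    ∑ (λ j → ∑ (λ i → atEnds i (total c i) (f j)))  ≡⟨ ∑-comm (λ j i → atEnds i (total c i) (f j)) ⟩
    ∑ (λ i → ∑ (λ j → atEnds i (total c i) (f j)))  ≤⟨ ∑-mono (λ i → twice i (total c i)) ⟩
    ∑ (λ i → total c i + total c i)                 ≡⟨ ∑-distrib-+ (total c) (total c) ⟩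
    ∑ (total c) + ∑ (total c)                       ≡⟨ cong (∑ (total c) +_) (sym (+-identityʳ _)) ⟩
    2 * ∑ (total c)                                 ≡⟨ cong (2 *_) (sym (totalCap-∑ E c)) ⟩
    2 * totalCap {E = E} c                          ∎
    where
    open ≤-Reasoning
    twice : ∀ i X → ∑ (λ j → atEnds i X (f j)) ≤ X + X
    twice i X = ≤-trans
      (≤-reflexive (∑-distrib-+ (λ j → mass (proj₁ (lookup E i)) X (f j)) (λ j → mass (proj₂ (lookup E i)) X (f j))))
      (+-mono-≤ (∑-mass-injective _ X f f-injective) (∑-mass-injective _ X f f-injective))

module Star (S : Graph n) (z : Fin n) (W : Subset n)
  (spokes : All (λ e → (proj₁ e ≡ z) ⊎ (proj₂ e ≡ z)) (E S))
  (covers : ∀ w → w ∈ W → w ≢ z → Any (λ e → (e ≡ (z , w)) ⊎ (e ≡ (w , z))) (E S)) where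

  open Network (E S)

  -- The hop along channel j towards the centre, the leaf it starts from,
  -- and the hop back.
  up : Ch (E S) → Hop (E S)
  up j = (j , not (does (proj₁ (lookup (E S) j) ≟ z)))

  leaf : Ch (E S) → Fin n
  leaf j = hopFrom (E S) (up j)

  down : Ch (E S) → Hop (E S)
  down j = reverse (up j)

  up-toCentre : ∀ j → hopTo (E S) (up j) ≡ z
  up-toCentre j with proj₁ (lookup (E S) j) ≟ z | All.lookup spokes (∈-lookup j)
  ... | yes first | _          = first
  ... | no  other | inj₁ first = contradiction first other
  ... | no  _     | inj₂ second = second

  down-fromCentre : ∀ j → hopFrom (E S) (down j) ≡ z
  down-fromCentre j = trans (hopFrom-reverse (up j)) (up-toCentre j)

  down-toLeaf : ∀ j → hopTo (E S) (down j) ≡ leaf j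
  down-toLeaf j = hopTo-reverse (up j)

  leaf-inV : ∀ j → leaf j ∈ V S
  leaf-inV j = proj₁ (hop-inV (E⊆V S) (up j))

  leaf≢centre : ∀ j → leaf j ≢ z
  leaf≢centre j = subst (leaf j ≢_) (up-toCentre j) (hop-noLoop (noLoop S) (up j))

  channel-ends : ∀ j → lookup (E S) j ≡ (leaf j , z) ⊎ lookup (E S) j ≡ (z , leaf j)
  channel-ends j =
    subst (λ c → lookup (E S) j ≡ (leaf j , c) ⊎ lookup (E S) j ≡ (c , leaf j)) (up-toCentre j) (hop-ends (up j))

  leaf-injective : ∀ {i j} → leaf i ≡ leaf j → i ≡ j
  leaf-injective {i} {j} same with i ≟ j
  ... | yes i≡j = i≡j
  ... | no  i≢j with channel-ends i | channel-ends j | distinct-channels (simple S) i≢j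
  ... | inj₁ eᵢ | inj₁ eⱼ | (unequal , _) = contradiction (trans eᵢ (trans (cong (_, z) same) (sym eⱼ))) unequal
  ... | inj₁ eᵢ | inj₂ eⱼ | (_ , unswapped) = contradiction (trans eᵢ (trans (cong (_, z) same) (cong swap (sym eⱼ)))) unswapped
  ... | inj₂ eᵢ | inj₁ eⱼ | (_ , unswapped) = contradiction (trans eᵢ (trans (cong (z ,_) same) (cong swap (sym eⱼ)))) unswapped
  ... | inj₂ eᵢ | inj₂ eⱼ | (unequal , _) = contradiction (trans eᵢ (trans (cong (z ,_) same) (sym eⱼ))) unequal

  leaf-of : ∀ w → w ∈ W → w ≢ z → Σ (Ch (E S)) λ j → leaf j ≡ w
  leaf-of w w∈W w≢z = index spoke , match (channel-ends (index spoke)) (lookup-index spoke)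
    where
    spoke = covers w w∈W w≢z
    match : ∀ {j e} → e ≡ (leaf j , z) ⊎ e ≡ (z , leaf j) → e ≡ (z , w) ⊎ e ≡ (w , z) → leaf j ≡ w
    match {j} (inj₁ eₗ) (inj₁ e) = contradiction (cong proj₁ (trans (sym eₗ) e)) (leaf≢centre j)
    match     (inj₁ eₗ) (inj₂ e) = cong proj₁ (trans (sym eₗ) e)
    match     (inj₂ eₗ) (inj₁ e) = cong proj₂ (trans (sym eₗ) e)
    match {j} (inj₂ eₗ) (inj₂ e) = contradiction (cong proj₂ (trans (sym eₗ) e)) (leaf≢centre j)

  -- The invariant: the channel of every leaf covers the leaf's requirements.
  Supplied : Balances (E S) → List (Tx n) → Set
  Supplied b ts = ∀ j → Funded ts (leaf j) (sides (up j) (b j))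

  supply : List (Tx n) → Balances (E S)
  supply T j = orient (proj₂ (up j)) (outNeed T (leaf j) , inNeed T (leaf j))

  supply-supplied : ∀ T → Supplied (supply T) T
  supply-supplied T j = subst (Funded T (leaf j)) (sym (orient-involutive (proj₂ (up j)) _)) (≤-refl , ≤-refl)

  supply-capital : ∀ T → totalCap {E = E S} (supply T) ≡ ∑ (λ j → outNeed T (leaf j) + inNeed T (leaf j))
  supply-capital T = trans (totalCap-∑ (E S) (supply T)) (sum-cong-≗ λ j → orient-total (proj₂ (up j)) _)

  module _ {t : Tx n} {ts : List (Tx n)} where

    SuppliedAt : Ch (E S) → Balances (E S) → List (Tx n) → Set
    SuppliedAt j b us = Funded us (leaf j) (sides (up j) (b j))

    private
      v = value t

      other-leaf : ∀ {i j x} → leaf i ≡ x → i ≢ j → x ≢ leaf j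
      other-leaf leafᵢ i≢j x≡leafⱼ = i≢j (leaf-injective (trans leafᵢ x≡leafⱼ))

      relabel : ∀ (us : List (Tx n)) {x y} q → x ≡ y → Funded us x q → Funded us y q
      relabel us q x≡y = subst (λ x → Funded us x q) x≡y

      not-leaf : ∀ {j x} → x ≡ z → x ≢ leaf j
      not-leaf {j} x≡z x≡leaf = leaf≢centre j (trans (sym x≡leaf) x≡z)

    send-up : ∀ {b} j → leaf j ≡ sender t → sender t ≢ receiver t → SuppliedAt j b (t ∷ ts) →
      CanMove {E = E S} v (up j) b × SuppliedAt j (move {E = E S} v (up j) b) ts
    send-up {b} j sender≡ s≢r supplied
      with fund-send t ts s≢r (relabel (t ∷ ts) (sides (up j) (b j)) sender≡ supplied)
    ... | v≤x , funded =
      canMove-intro v (up j) b v≤x ,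
      subst (Funded ts (leaf j)) (sym (move-on v (up j) b)) (relabel ts (pay v (sides (up j) (b j))) (sym sender≡) funded)

    receive-down : ∀ {b} j → leaf j ≡ receiver t → sender t ≢ receiver t → SuppliedAt j b (t ∷ ts) →
      CanMove {E = E S} v (down j) b × SuppliedAt j (move {E = E S} v (down j) b) ts
    receive-down {b} j receiver≡ s≢r supplied
      with fund-receive t ts s≢r (relabel (t ∷ ts) (sides (up j) (b j)) receiver≡ supplied)
    ... | v≤y , funded =
      canMove-reverse v (up j) b v≤y ,
      subst (Funded ts (leaf j)) (sym (move-reverse v (up j) b)) (relabel ts (receive v (sides (up j) (b j))) (sym receiver≡) funded)

    StarStep : Balances (E S) → Set
    StarStep b = Σ (List (Hop (E S))) λ p → Σ (Balances (E S)) λ b₁ →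
      IsPath (E S) (sender t) (receiver t) p × Route (E S) v b p b₁ × Supplied b₁ ts

    step-loop : ∀ {b} → sender t ≡ receiver t → Supplied b (t ∷ ts) → StarStep b
    step-loop s≡r supplied = [] , _ , path₀ s≡r , done , λ j → fund-loop t ts (leaf j) s≡r (supplied j)

    step-toCentre : ∀ {b} js → leaf js ≡ sender t → receiver t ≡ z → sender t ≢ receiver t →
      Supplied b (t ∷ ts) → StarStep b
    step-toCentre {b} js sender≡ r≡z s≢r supplied with send-up js sender≡ s≢r (supplied js)
    ... | canMove , suppliedⱼ =
      up js ∷ [] , _ , path₁ (up js) s≢r sender≡ (trans (up-toCentre js) (sym r≡z)) , hop canMove done ,
      update-at (λ j p → Funded ts (leaf j) (sides (up j) p)) js (move-elsewhere v (up js) b) suppliedⱼ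
        (λ j js≢j → fund-idle t ts (leaf j) (other-leaf sender≡ js≢j) (not-leaf r≡z) (supplied j))

    step-fromCentre : ∀ {b} jr → sender t ≡ z → leaf jr ≡ receiver t → sender t ≢ receiver t →
      Supplied b (t ∷ ts) → StarStep b
    step-fromCentre {b} jr s≡z receiver≡ s≢r supplied with receive-down jr receiver≡ s≢r (supplied jr)
    ... | canMove , suppliedⱼ =
      down jr ∷ [] , _ ,
      path₁ (down jr) s≢r (trans (down-fromCentre jr) (sym s≡z)) (trans (down-toLeaf jr) receiver≡) ,
      hop canMove done ,
      update-at (λ j p → Funded ts (leaf j) (sides (up j) p)) jr (move-elsewhere v (down jr) b) suppliedⱼ
        (λ j jr≢j → fund-idle t ts (leaf j) (not-leaf s≡z) (other-leaf receiver≡ jr≢j) (supplied j))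

    step-viaCentre : ∀ {b} js jr → leaf js ≡ sender t → leaf jr ≡ receiver t → sender t ≢ receiver t →
      Supplied b (t ∷ ts) → StarStep b
    step-viaCentre {b} js jr sender≡ receiver≡ s≢r supplied =
      up js ∷ down jr ∷ [] , _ ,
      path₂ (up js) (down jr) (leaf≢centre js ∘′ trans sender≡) (leaf≢centre jr ∘′ trans receiver≡ ∘′ sym) s≢r
        sender≡ (up-toCentre js) (down-fromCentre jr) (trans (down-toLeaf jr) receiver≡) ,
      hop (proj₁ first) (hop (proj₁ second) done) ,
      update-at (λ j p → Funded ts (leaf j) (sides (up j) p)) jr (move-elsewhere v (down jr) b₁) (proj₂ second)
        (update-at (λ j p → jr ≢ j → Funded ts (leaf j) (sides (up j) p)) js (move-elsewhere v (up js) b) (λ _ → proj₂ first)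
           (λ j js≢j jr≢j → fund-idle t ts (leaf j) (other-leaf sender≡ js≢j) (other-leaf receiver≡ jr≢j) (supplied j)))
      where
      js≢jr : js ≢ jr
      js≢jr js≡jr = s≢r (trans (sym sender≡) (trans (cong leaf js≡jr) receiver≡))
      b₁ = move {E = E S} v (up js) b
      first = send-up js sender≡ s≢r (supplied js)
      second = receive-down {b₁} jr receiver≡ s≢r
        (subst (λ p → Funded (t ∷ ts) (leaf jr) (sides (up jr) p)) (sym (move-elsewhere v (up js) b jr js≢jr)) (supplied jr))

    star-step : ∀ {b} → (sender t ≢ receiver t → (sender t ∈ W) × (receiver t ∈ W)) →
      Supplied b (t ∷ ts) → StarStep b
    star-step inW supplied with sender t ≟ receiver t
    ... | yes s≡r = step-loop s≡r supplied
    ... | no  s≢r with inW s≢r | sender t ≟ z | receiver t ≟ z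
    ...   | _           | yes s≡z | yes r≡z = contradiction (trans s≡z (sym r≡z)) s≢r
    ...   | (s∈W , _)   | no  s≢z | yes r≡z with leaf-of _ s∈W s≢z
    ...     | js , sender≡ = step-toCentre js sender≡ r≡z s≢r supplied
    star-step inW supplied | no s≢r | (_ , r∈W) | yes s≡z | no r≢z with leaf-of _ r∈W r≢z
    ...     | jr , receiver≡ = step-fromCentre jr s≡z receiver≡ s≢r supplied
    star-step inW supplied | no s≢r | (s∈W , r∈W) | no s≢z | no r≢z with leaf-of _ s∈W s≢z | leaf-of _ r∈W r≢z
    ...     | js , sender≡ | jr , receiver≡ = step-viaCentre js jr sender≡ receiver≡ s≢r supplied

  star-exec : ∀ {b ts} → All (λ t → sender t ≢ receiver t → (sender t ∈ W) × (receiver t ∈ W)) ts →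
    Supplied b ts → Σ (Balances (E S)) λ b′ → Exec (E S) b ts b′
  star-exec [] _ = _ , done
  star-exec {ts = t ∷ ts} (inW ∷ inWs) supplied with star-step {t} {ts} inW supplied
  ... | p , _ , path , route , supplied₁ with star-exec inWs supplied₁
  ...   | b′ , exec = b′ , run p path route exec

least : (P : ℕ → Set) → (∀ k → Dec (P k)) → ∀ {B} → P B → Σ ℕ λ k → P k × (∀ k′ → P k′ → k ≤ k′)
least P P? {zero}  p = 0 , p , λ _ _ → z≤n
least P P? {suc B} p with P? 0
... | yes p₀ = 0 , p₀ , λ _ _ → z≤n
... | no ¬p₀ with least (λ k → P (suc k)) (λ k → P? (suc k)) p
...   | k , pₖ , minimal = suc k , pₖ , λ where
          zero    p₀′ → contradiction p₀′ ¬p₀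
          (suc k′) p′ → s≤s (minimal k′ p′)

module Reachability (E : List (Edge n)) (z : Fin n) where

  Next : (Fin n → Set) → Fin n → Edge n → Set
  Next P x e = (proj₁ e ≡ x × P (proj₂ e)) ⊎ (proj₂ e ≡ x × P (proj₁ e))

  Reach : ℕ → Fin n → Set
  Reach zero    x = x ≡ z
  Reach (suc k) x = Reach k x ⊎ Any (Next (Reach k) x) E

  reach? : ∀ k x → Dec (Reach k x)
  reach? zero    x = x ≟ z
  reach? (suc k) x =
    reach? k x ⊎-dec any? (λ e → (proj₁ e ≟ x ×-dec reach? k (proj₂ e)) ⊎-dec (proj₂ e ≟ x ×-dec reach? k (proj₁ e))) E

  walk-reach : ∀ {x p vs} → Walk E x z p vs → Reach (length p) x
  walk-reach here                         = refl
  walk-reach (step (i , true)  refl walk) = inj₂ (lose (∈-lookup i) (inj₁ (refl , walk-reach walk)))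
  walk-reach (step (i , false) refl walk) = inj₂ (lose (∈-lookup i) (inj₂ (refl , walk-reach walk)))

  -- The channel through which w is reached from z at the least depth
  -- (w's parent channel in a breadth-first tree rooted at z).
  record Parent (w : Fin n) : Set where
    field
      depth   : ℕ
      channel : Ch E
      link    : Next (Reach depth) w (lookup E channel)
      first   : ∀ k → Reach k w → suc depth ≤ k

  parent : ∀ w → w ≢ z → Σ (List (Hop E)) (λ p → Σ (List (Fin n)) λ vs → Walk E w z p vs) → Parent w
  parent w w≢z (_ , _ , walk) with least (λ k → Reach k w) (λ k → reach? k w) (walk-reach walk)
  ... | zero  , w≡z        , _       = contradiction w≡z w≢z
  ... | suc k , inj₁ early , minimal = contradiction (minimal k early) (<-irrefl refl)
  ... | suc k , inj₂ link  , minimal = record { depth = k ; channel = index link ; link = lookup-index link ; first = minimal }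

  -- Distinct nodes have distinct parent channels: a shared channel would
  -- make each of its ends strictly shallower than the other.
  parent-injective : ∀ {w w′} (P : Parent w) (P′ : Parent w′) → Parent.channel P ≡ Parent.channel P′ → w ≡ w′
  parent-injective {w} {w′} P P′ same =
    compare (Parent.link P) (subst (λ c → Next (Reach d′) w′ (lookup E c)) (sym same) (Parent.link P′))
    where
    d = Parent.depth P
    d′ = Parent.depth P′
    cycle : Reach d w′ → Reach d′ w → ⊥
    cycle r r′ = <-irrefl refl (≤-trans (Parent.first P d′ r′) (≤-trans (n≤1+n d′) (Parent.first P′ d r)))
    compare : ∀ {e} → Next (Reach d) w e → Next (Reach d′) w′ e → w ≡ w′
    compare (inj₁ (a , _)) (inj₁ (b , _))  = trans (sym a) b
    compare (inj₁ (a , r)) (inj₂ (b , r′)) = ⊥-elim (cycle (subst (Reach d) b r) (subst (Reach d′) a r′))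
    compare (inj₂ (a , r)) (inj₁ (b , r′)) = ⊥-elim (cycle (subst (Reach d) b r) (subst (Reach d′) a r′))
    compare (inj₂ (a , _)) (inj₂ (b , _))  = trans (sym a) b

  channels-bound : ∀ {m} (f : Fin m → Fin n) → (∀ {i j} → f i ≡ f j → i ≡ j) → (∀ j → f j ≢ z) →
    (∀ j → Σ (List (Hop E)) λ p → Σ (List (Fin n)) λ vs → Walk E (f j) z p vs) → m ≤ length E
  channels-bound f f-injective f≢z walks =
    injective⇒≤ (λ same → f-injective (parent-injective (parent-of _) (parent-of _) same))
    where
    parent-of : ∀ j → Parent (f j)
    parent-of j = parent (f j) (f≢z j) (walks j)

ℕtoℚ-mono : ∀ {a b} → a ≤ b → ℕtoℚ a ≤ℚ ℕtoℚ b
ℕtoℚ-mono {a} {b} a≤b =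
  subst₂ _≤ℚ_ (sym (normalize-coprime (Coprime.sym (1-coprimeTo a)))) (sym (normalize-coprime (Coprime.sym (1-coprimeTo b))))
    (*≤* (subst₂ ℤ._≤_ (sym (ℤ.*-identityʳ (ℤ.+ a))) (sym (ℤ.*-identityʳ (ℤ.+ b))) (ℤ.+≤+ a≤b)))

profit-antitone : ∀ ε (G S : Graph n) T → length (E S) ≤ length (E G) → profit ε G T ≤ℚ profit ε S T
profit-antitone ε G S T fewer =
  +-monoʳ-≤ℚ ((ℕtoℚ 1 ℚ.- ε) ℚ.* ℕtoℚ (length T)) (neg-antimono-≤ (ℕtoℚ-mono fewer))

theorem10 : ∀ {n} (ε : ℚ) → 0ℚ <ℚ ε → ε <ℚ 1ℚ →
    (ts : List (Tx n)) → All (λ t → 0 < value t) ts →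
    (G : Graph n) (T : List (Tx n)) (c : Balances (E G)) →
    Optimal ε ts G T c → Connected G →
    (S : Graph n) (z : Fin n) → IsStar S (V G) z →
    Σ (Balances (E S)) λ cS →
      Feasible ts S T cS ×
      totalCap {E = E S} cS ≤ 2 * totalCap {E = E G} c ×
      profit ε G T ≤ℚ profit ε S T
theorem10 ε _ _ _ _ G T c ((T⊆ts , _ , exec) , _) connected S z (V≡ , z∈V , spokes , covers) =
  supply T , (T⊆ts , star-exec (G.exec-inV (E⊆V G) exec) (supply-supplied T)) , capital ,
  profit-antitone ε G S T fewer
  where
  module G = Network (E G)
  open Star S z (V G) spokes covers

  capital : totalCap {E = E S} (supply T) ≤ 2 * totalCap {E = E G} c
  capital = begin
    totalCap {E = E S} (supply T)                        ≡⟨ supply-capital T ⟩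
    ∑ (λ j → outNeed T (leaf j) + inNeed T (leaf j))     ≤⟨ ∑-mono (λ j → +-mono-≤ (G.outNeed-bound (noLoop G) exec (leaf j))
                                                                                    (G.inNeed-bound (noLoop G) exec (leaf j))) ⟩
    ∑ (λ j → G.held c (leaf j) + G.facing c (leaf j))   ≤⟨ G.capital-twice c leaf leaf-injective ⟩
    2 * totalCap {E = E G} c                             ∎
    where open ≤-Reasoning

  fewer : length (E S) ≤ length (E G)
  fewer = Reachability.channels-bound (E G) z leaf leaf-injective leaf≢centre
    (λ j → connected (leaf j) z (subst (leaf j ∈_) V≡ (leaf-inV j)) z∈V)
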